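{- Let $L$ be a join-semilattice with finite connected decompositions, let $(M,B)$ be a finite duality in $L$, and suppose $M$ is a transversal of $M$. Then $\overline M=M_{\mathrm{Cn}}\setminus{\uparrow}M=\emptyset$, and $M$ is the only transversal of $M$.
   Context: $L$ is a join-semilattice. For $M\subseteq L$: ${\downarrow}M=\{x:\exists m\in M,\ x\le m\}$, ${\uparrow}M=\{x:\exists m\in M,\ x\ge m\}$. An element $a$ is connected if $a\le b\vee c$ implies $a\le b$ or $a\le c$; $\mathrm{Cn}\,L$ is the set of connected elements. $L$ has finite connected decompositions if every $a$ equals $\bigvee F$ for some finite $F\subseteq\mathrm{Cn}\,L$. A connected component of $a$ is a $c\in\mathrm{Cn}\,L$ such that $a=c$ or $a=b\vee c\ne b$ for some $b$; for $A\subseteq L$, $A_{\mathrm{Cn}}$ is the set of connected components of elements of $A$. A finite duality is a pair $(A,B)$ of finite subsets, each consisting of pairwise incomparable elements, with ${\downarrow}B=L\setminus{\uparrow}A$. For antichains $M,N$: $M\sqsubseteq N$ iff $N\subseteq{\uparrow}M$. A quasitransversal of $A$ is an antichain $N\subseteq A_{\mathrm{Cn}}$ with $A\subseteq{\uparrow}N$; a transversal of $A$ is a quasitransversal $N$ with no quasitransversal $N'\neq N$ satisfying $N\sqsubseteq N'$. For a quasitransversal $N$ of $A$, $\overline N=A_{\mathrm{Cn}}\setminus{\uparrow}N$. -}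

module Defs where

open import Level using (Level; _⊔_; Lift)
open import Data.Product using (Σ; ∃; _×_; _,_)
open import Data.Sum using (_⊎_)
open import Data.List using (List)
open import Data.List.NonEmpty using (List⁺; foldr₁; toList)
open import Data.List.Relation.Unary.All using (All)
open import Data.List.Membership.Propositional using (_∈_)
open import Relation.Nullary using (¬_)
open import Relation.Unary using (Pred)
open import Relation.Binary using (Rel)
open import Relation.Binary.PropositionalEquality using (_≡_)
open import Relation.Binary.Lattice.Structures using (IsJoinSemilattice)
open import Algebra.Core using (Op₂)

-- A join-semilattice (L, ≤, ∨) whose underlying equality is propositional equality.
-- Finite subsets of L are lists; arbitrary subsets are predicates of level c ⊔ ℓ.
module JoinSemilatticeNotions
  {c ℓ : Level} {L : Set c} {_≤_ : Rel L ℓ} {_∨_ : Op₂ L}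
  (isJS : IsJoinSemilattice _≡_ _≤_ _∨_) where

  Subset : Set _
  Subset = Pred L (c ⊔ ℓ)

  ⟦_⟧ : List L → Subset
  ⟦ A ⟧ x = Lift (c ⊔ ℓ) (x ∈ A)

  ↓_ : Subset → Subset
  (↓ M) x = ∃ λ m → M m × x ≤ m

  ↑_ : Subset → Subset
  (↑ M) x = ∃ λ m → M m × m ≤ x

  _⊆_ : Subset → Subset → Set _
  M ⊆ N = ∀ x → M x → N x

  _≐_ : Subset → Subset → Set _
  M ≐ N = M ⊆ N × N ⊆ M

  IsEmpty : Subset → Set _
  IsEmpty M = ∀ x → ¬ M x

  Antichain : Subset → Set _
  Antichain M = ∀ x y → M x → M y → x ≤ y → x ≡ y

  Connected : L → Set _
  Connected a = ∀ b c → a ≤ (b ∨ c) → a ≤ b ⊎ a ≤ c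

  CnL : Subset
  CnL = Connected

  ⋁ : List⁺ L → L
  ⋁ = foldr₁ _∨_

  FiniteConnectedDecompositions : Set _
  FiniteConnectedDecompositions =
    ∀ a → ∃ λ (F : List⁺ L) → All Connected (toList F) × a ≡ ⋁ F

  ConnectedComponentOf : L → L → Set _
  ConnectedComponentOf a c =
    Connected c × (a ≡ c ⊎ ∃ λ b → a ≡ (b ∨ c) × ¬ ((b ∨ c) ≡ b))

  _Cn : Subset → Subset
  (A Cn) c = ∃ λ a → A a × ConnectedComponentOf a c

  FiniteDuality : List L → List L → Set _
  FiniteDuality A B =
    Antichain ⟦ A ⟧ × Antichain ⟦ B ⟧ ×
    (∀ x → ((↓ ⟦ B ⟧) x → ¬ (↑ ⟦ A ⟧) x) × (¬ (↑ ⟦ A ⟧) x → (↓ ⟦ B ⟧) x))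

  _⊑_ : Subset → Subset → Set _
  M ⊑ N = N ⊆ (↑ M)

  Quasitransversal : Subset → Subset → Set _
  Quasitransversal A N = Antichain N × N ⊆ (A Cn) × A ⊆ (↑ N)

  Transversal : Subset → Subset → Set _
  Transversal A N =
    Quasitransversal A N ×
    (∀ (N' : Subset) → Quasitransversal A N' → N ⊑ N' → N' ≐ N)

  bar : Subset → Subset → Subset
  bar A N x = (A Cn) x × ¬ (↑ N) x

-- A transversal M of itself lies in M_Cn, so every m ∈ M is connected. A connected
-- element lies below each of its connected components: if m = b ∨ c ≠ b, then m ≤ b
-- is impossible, so m ≤ c. Hence M_Cn ⊆ ↑M, i.e. M̄ = ∅. Moreover M is a
-- quasitransversal of M lying above any transversal N (as M ⊆ ↑N), so maximality
-- of N forces N = M.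
module Submission where

open import Defs
open import Level using (Level)
open import Data.Empty using (⊥-elim)
open import Data.Product using (_×_; _,_; swap)
open import Data.Sum using (inj₁; inj₂)
open import Data.List using (List)
open import Relation.Binary using (Rel)
open import Relation.Binary.PropositionalEquality as ≡ using (_≡_; sym; subst)
open import Relation.Binary.Lattice.Structures using (IsJoinSemilattice)
open import Algebra.Core using (Op₂)

module _ {c ℓ : Level} {L : Set c} {_≤_ : Rel L ℓ} {_∨_ : Op₂ L}
         (isJS : IsJoinSemilattice _≡_ _≤_ _∨_) where

  open JoinSemilatticeNotions isJS
  open IsJoinSemilattice isJS using (reflexive; antisym; trans; x≤x∨y)

  connected⇒≤component : ∀ {a c} → Connected a → ConnectedComponentOf a c → a ≤ c
  connected⇒≤component _ (_ , inj₁ a≡c) = reflexive a≡c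
  connected⇒≤component {a} {c} conA (_ , inj₂ (b , a≡b∨c , b∨c≢b))
    with conA b c (reflexive a≡b∨c)
  ... | inj₂ a≤c = a≤c
  ... | inj₁ a≤b = ⊥-elim (b∨c≢b (≡.trans (sym a≡b∨c) (antisym a≤b b≤a)))
    where
    b≤a : b ≤ a
    b≤a = subst (b ≤_) (sym a≡b∨c) (x≤x∨y b c)

  Cn⊆CnL : ∀ A → (A Cn) ⊆ CnL
  Cn⊆CnL A _ (_ , _ , conX , _) = conX

  ⊆↑ : ∀ A → A ⊆ (↑ A)
  ⊆↑ A a Aa = a , Aa , reflexive ≡.refl

  bar-empty : ∀ {A N} → A ⊆ CnL → A ⊆ (↑ N) → IsEmpty (bar A N)
  bar-empty A⊆CnL A⊆↑N x ((a , Aa , component) , x∉↑N) =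
    let (n , Nn , n≤a) = A⊆↑N a Aa
    in x∉↑N (n , Nn , trans n≤a (connected⇒≤component (A⊆CnL a Aa) component))

  quasitransversal-self⇒⊆CnL : ∀ {A} → Quasitransversal A A → A ⊆ CnL
  quasitransversal-self⇒⊆CnL {A} (_ , A⊆ACn , _) a Aa = Cn⊆CnL A a (A⊆ACn a Aa)

  transversal≐quasitransversal-self :
    ∀ {A N} → Quasitransversal A A → Transversal A N → N ≐ A
  transversal≐quasitransversal-self qtA ((_ , _ , A⊆↑N) , maximal) =
    swap (maximal _ qtA A⊆↑N)

mainTheorem10 : {c ℓ : Level} {L : Set c} {_≤_ : Rel L ℓ} {_∨_ : Op₂ L}
    (isJS : IsJoinSemilattice _≡_ _≤_ _∨_) →
    let open JoinSemilatticeNotions isJS in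
    FiniteConnectedDecompositions →
    (M B : List L) → FiniteDuality M B →
    Transversal ⟦ M ⟧ ⟦ M ⟧ →
    IsEmpty (bar ⟦ M ⟧ ⟦ M ⟧) ×
    (∀ (N : Subset) → Transversal ⟦ M ⟧ N → N ≐ ⟦ M ⟧)
mainTheorem10 isJS _ M _ _ (qtM , _) =
  bar-empty isJS (quasitransversal-self⇒⊆CnL isJS qtM) (⊆↑ isJS _) ,
  λ N → transversal≐quasitransversal-self isJS qtM
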